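{- Let $R\in\mathcal{R}$. Then (1) $R\subseteq\mathcal{N}$, and (2) $R$ contains every $\lambda$-variable.
   Context: There are two disjoint sets of variables: $\lambda$-variables $x,y,\dots$ and $\mu$-variables $a,b,\dots$. Terms $t$ and $\mathcal{E}$-terms $\varepsilon$ are given by $t ::= x \mid \lambda x.t \mid (t\;\varepsilon) \mid \langle t,t\rangle \mid \omega_1 t \mid \omega_2 t \mid \mu a.t \mid (a\;t)$, $\varepsilon ::= t \mid \pi_1 \mid \pi_2 \mid [x.t,y.t]$; $\mathcal{T}$ is the set of terms. One-step reduction $\triangleright$ is the closure under all contexts of the rules: $(\lambda x.u\;v)\triangleright u[x:=v]$; $(\langle t_1,t_2\rangle\;\pi_i)\triangleright t_i$; $(\omega_i t\;[x_1.u_1,x_2.u_2])\triangleright u_i[x_i:=t]$; $((t\;[x_1.u_1,x_2.u_2])\;\varepsilon)\triangleright (t\;[x_1.(u_1\;\varepsilon),x_2.(u_2\;\varepsilon)])$; $(\mu a.t\;\varepsilon)\triangleright \mu a.t[a:=^*\varepsilon]$, where $t[a:=^*\varepsilon]$ replaces inductively each subterm $(a\;v)$ of $t$ by $(a\;(v\;\varepsilon))$. The paper considers only typed terms (typable in the natural-deduction system for classical propositional logic with $\perp,\to,\wedge,\vee$). $\mathcal{N}$ is the set of strongly normalizable terms (no infinite reduction sequence). For sets $K,L$ of terms: $K\to L=\{t\in\mathcal{T}:\ (t\;u)\in L \text{ for each } u\in K\}$; $K\wedge L=\{t\in\mathcal{T}:\ (t\;\pi_1)\in K \text{ and } (t\;\pi_2)\in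 L\}$; $K\vee L=\{t\in\mathcal{T}:$ for all $\lambda$-variables $x,y$ and all $u,v\in\mathcal{N}$, if $u[x:=r]\in\mathcal{N}$ and $v[y:=s]\in\mathcal{N}$ for all $r\in K,s\in L$, then $(t\;[x.u,y.v])\in\mathcal{N}\}$. The set $\mathcal{R}$ of reducibility candidates is the smallest set of subsets of terms containing $\mathcal{N}$ and closed under $\to,\wedge,\vee$. -}

module Defs where

open import Data.Nat using (ℕ; zero; suc; _≡ᵇ_)
open import Data.Bool using (if_then_else_)
open import Data.Product using (_×_)
open import Level using (0ℓ) renaming (suc to lsuc)
open import Relation.Unary using (Pred; _∈_)
open import Induction.WellFounded using (Acc)

-- Syntax (de Bruijn indices; two disjoint index spaces:
-- λ-variables (var, bound by lam and by the two branches of case) and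
-- μ-variables (nm a t = (a t), bound by mu)).

mutual
  data Tm : Set where
    var  : ℕ → Tm
    lam  : Tm → Tm
    app  : Tm → Elim → Tm
    pair : Tm → Tm → Tm
    in₁  : Tm → Tm
    in₂  : Tm → Tm
    mu   : Tm → Tm
    nm   : ℕ → Tm → Tm

  data Elim : Set where
    tm   : Tm → Elim
    π₁   : Elim
    π₂   : Elim
    case : Tm → Tm → Elim

ext : (ℕ → ℕ) → ℕ → ℕ
ext ρ zero    = zero
ext ρ (suc n) = suc (ρ n)

mutual
  renλ : (ℕ → ℕ) → Tm → Tm
  renλ ρ (var x)    = var (ρ x)
  renλ ρ (lam t)    = lam (renλ (ext ρ) t)
  renλ ρ (app t e)  = app (renλ ρ t) (renλE ρ e)
  renλ ρ (pair t u) = pair (renλ ρ t) (renλ ρ u)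
  renλ ρ (in₁ t)    = in₁ (renλ ρ t)
  renλ ρ (in₂ t)    = in₂ (renλ ρ t)
  renλ ρ (mu t)     = mu (renλ ρ t)
  renλ ρ (nm a t)   = nm a (renλ ρ t)

  renλE : (ℕ → ℕ) → Elim → Elim
  renλE ρ (tm t)     = tm (renλ ρ t)
  renλE ρ π₁         = π₁
  renλE ρ π₂         = π₂
  renλE ρ (case u v) = case (renλ (ext ρ) u) (renλ (ext ρ) v)

mutual
  renμ : (ℕ → ℕ) → Tm → Tm
  renμ ρ (var x)    = var x
  renμ ρ (lam t)    = lam (renμ ρ t)
  renμ ρ (app t e)  = app (renμ ρ t) (renμE ρ e)
  renμ ρ (pair t u) = pair (renμ ρ t) (renμ ρ u)
  renμ ρ (in₁ t)    = in₁ (renμ ρ t)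
  renμ ρ (in₂ t)    = in₂ (renμ ρ t)
  renμ ρ (mu t)     = mu (renμ (ext ρ) t)
  renμ ρ (nm a t)   = nm (ρ a) (renμ ρ t)

  renμE : (ℕ → ℕ) → Elim → Elim
  renμE ρ (tm t)     = tm (renμ ρ t)
  renμE ρ π₁         = π₁
  renμE ρ π₂         = π₂
  renμE ρ (case u v) = case (renμ ρ u) (renμ ρ v)

extsλ : (ℕ → Tm) → ℕ → Tm
extsλ σ zero    = var zero
extsλ σ (suc n) = renλ suc (σ n)

mutual
  substλ : (ℕ → Tm) → Tm → Tm
  substλ σ (var x)    = σ x
  substλ σ (lam t)    = lam (substλ (extsλ σ) t)
  substλ σ (app t e)  = app (substλ σ t) (substλE σ e)
  substλ σ (pair t u) = pair (substλ σ t) (substλ σ u)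
  substλ σ (in₁ t)    = in₁ (substλ σ t)
  substλ σ (in₂ t)    = in₂ (substλ σ t)
  substλ σ (mu t)     = mu (substλ (λ n → renμ suc (σ n)) t)
  substλ σ (nm a t)   = nm a (substλ σ t)

  substλE : (ℕ → Tm) → Elim → Elim
  substλE σ (tm t)     = tm (substλ σ t)
  substλE σ π₁         = π₁
  substλE σ π₂         = π₂
  substλE σ (case u v) = case (substλ (extsλ σ) u) (substλ (extsλ σ) v)

sub0 : Tm → ℕ → Tm
sub0 r zero    = r
sub0 r (suc n) = var n

-- u [x:= r]  where x is the λ-variable bound by the enclosing binder (index 0)
_[0:=_] : Tm → Tm → Tm
u [0:= r ] = substλ (sub0 r) u

-- t [a :=* ε] : replace inductively each subterm (a v) by (a (v ε))
mutual
  msub : ℕ → Elim → Tm → Tm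
  msub a e (var x)    = var x
  msub a e (lam t)    = lam (msub a (renλE suc e) t)
  msub a e (app t f)  = app (msub a e t) (msubE a e f)
  msub a e (pair t u) = pair (msub a e t) (msub a e u)
  msub a e (in₁ t)    = in₁ (msub a e t)
  msub a e (in₂ t)    = in₂ (msub a e t)
  msub a e (mu t)     = mu (msub (suc a) (renμE suc e) t)
  msub a e (nm b t)   =
    if b ≡ᵇ a then nm b (app (msub a e t) e) else nm b (msub a e t)

  msubE : ℕ → Elim → Elim → Elim
  msubE a e (tm t)     = tm (msub a e t)
  msubE a e π₁         = π₁
  msubE a e π₂         = π₂
  msubE a e (case u v) = case (msub a (renλE suc e) u) (msub a (renλE suc e) v)

infix 4 _▷_ _▷E_

mutual
  data _▷_ : Tm → Tm → Set where
    β    : ∀ {u v} → app (lam u) (tm v) ▷ u [0:= v ]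
    π₁β  : ∀ {t₁ t₂} → app (pair t₁ t₂) π₁ ▷ t₁
    π₂β  : ∀ {t₁ t₂} → app (pair t₁ t₂) π₂ ▷ t₂
    ι₁   : ∀ {t u₁ u₂} → app (in₁ t) (case u₁ u₂) ▷ u₁ [0:= t ]
    ι₂   : ∀ {t u₁ u₂} → app (in₂ t) (case u₁ u₂) ▷ u₂ [0:= t ]
    comm : ∀ {t u₁ u₂ e} →
           app (app t (case u₁ u₂)) e ▷
           app t (case (app u₁ (renλE suc e)) (app u₂ (renλE suc e)))
    μβ   : ∀ {t e} → app (mu t) e ▷ mu (msub zero (renμE suc e) t)
    ξlam  : ∀ {t t'} → t ▷ t' → lam t ▷ lam t'
    ξappl : ∀ {t t' e} → t ▷ t' → app t e ▷ app t' e
    ξappr : ∀ {t e e'} → e ▷E e' → app t e ▷ app t e'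
    ξpairl : ∀ {t t' u} → t ▷ t' → pair t u ▷ pair t' u
    ξpairr : ∀ {t u u'} → u ▷ u' → pair t u ▷ pair t u'
    ξin₁  : ∀ {t t'} → t ▷ t' → in₁ t ▷ in₁ t'
    ξin₂  : ∀ {t t'} → t ▷ t' → in₂ t ▷ in₂ t'
    ξmu   : ∀ {t t'} → t ▷ t' → mu t ▷ mu t'
    ξnm   : ∀ {a t t'} → t ▷ t' → nm a t ▷ nm a t'

  data _▷E_ : Elim → Elim → Set where
    ξtm    : ∀ {t t'} → t ▷ t' → tm t ▷E tm t'
    ξcasel : ∀ {u u' v} → u ▷ u' → case u v ▷E case u' v
    ξcaser : ∀ {u v v'} → v ▷ v' → case u v ▷E case u v'

_◁_ : Tm → Tm → Set
u ◁ t = t ▷ u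

𝒩 : Pred Tm 0ℓ
𝒩 = Acc _◁_

_⇒ᶜ_ : Pred Tm 0ℓ → Pred Tm 0ℓ → Pred Tm 0ℓ
(K ⇒ᶜ L) t = ∀ u → u ∈ K → app t (tm u) ∈ L

_∧ᶜ_ : Pred Tm 0ℓ → Pred Tm 0ℓ → Pred Tm 0ℓ
(K ∧ᶜ L) t = (app t π₁ ∈ K) × (app t π₂ ∈ L)

-- the λ-variables x,y of [x.u,y.v] are the de Bruijn binders (index 0)
_∨ᶜ_ : Pred Tm 0ℓ → Pred Tm 0ℓ → Pred Tm 0ℓ
(K ∨ᶜ L) t = ∀ u v → u ∈ 𝒩 → v ∈ 𝒩 →
             (∀ r → r ∈ K → u [0:= r ] ∈ 𝒩) →
             (∀ s → s ∈ L → v [0:= s ] ∈ 𝒩) →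
             app t (case u v) ∈ 𝒩

data ℛ : Pred Tm 0ℓ → Set₁ where
  𝒩∈ℛ : ℛ 𝒩
  ⇒∈ℛ : ∀ {K L} → ℛ K → ℛ L → ℛ (K ⇒ᶜ L)
  ∧∈ℛ : ∀ {K L} → ℛ K → ℛ L → ℛ (K ∧ᶜ L)
  ∨∈ℛ : ∀ {K L} → ℛ K → ℛ L → ℛ (K ∨ᶜ L)

-- A neutral term (a variable followed by eliminations whose arguments are
-- strongly normalizable) never becomes a head redex, so eliminating it with a
-- strongly normalizable elimination stays strongly normalizable; hence neutral
-- terms are in 𝒩. Every candidate then contains all neutral terms and is
-- contained in 𝒩, by induction on ℛ: membership in K ⇒ᶜ L, K ∧ᶜ L or K ∨ᶜ L is
-- tested by applying to a neutral term (a variable in K, or variable branches),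
-- and strong normalization of an application descends to its head.
module Submission where

open import Defs
open import Data.Nat using (ℕ)
open import Data.Product using (_×_; _,_)
open import Level using (0ℓ)
open import Relation.Unary using (Pred; _⊆_; _∈_)
open import Induction.WellFounded using (Acc; acc)

-- No case eliminations: a further elimination of (t [x.u,y.v]) fires comm.
data Neutral : Tm → Set where
  var : ∀ {x} → Neutral (var x)
  app : ∀ {t w} → Neutral t → 𝒩 w → Neutral (app t (tm w))
  π₁  : ∀ {t} → Neutral t → Neutral (app t π₁)
  π₂  : ∀ {t} → Neutral t → Neutral (app t π₂)

Neutral-▷ : ∀ {t t'} → Neutral t → t ▷ t' → Neutral t'
Neutral-▷ (app n w) (ξappl r)             = app (Neutral-▷ n r) w
Neutral-▷ (app n (acc w)) (ξappr (ξtm r)) = app n (w r)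
Neutral-▷ (π₁ n) (ξappl r)                = π₁ (Neutral-▷ n r)
Neutral-▷ (π₂ n) (ξappl r)                = π₂ (Neutral-▷ n r)
Neutral-▷ (app () _) β
Neutral-▷ (app () _) comm
Neutral-▷ (app () _) μβ
Neutral-▷ (π₁ ()) π₁β
Neutral-▷ (π₁ ()) comm
Neutral-▷ (π₁ ()) μβ
Neutral-▷ (π₁ _) (ξappr ())
Neutral-▷ (π₂ ()) π₂β
Neutral-▷ (π₂ ()) comm
Neutral-▷ (π₂ ()) μβ
Neutral-▷ (π₂ _) (ξappr ())

_◁E_ : Elim → Elim → Set
e' ◁E e = e ▷E e'

𝒩ᴱ : Elim → Set
𝒩ᴱ = Acc _◁E_

𝒩ᴱ-tm : ∀ {w} → 𝒩 w → 𝒩ᴱ (tm w)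
𝒩ᴱ-tm (acc w) = acc λ { (ξtm r) → 𝒩ᴱ-tm (w r) }

𝒩ᴱ-case : ∀ {u v} → 𝒩 u → 𝒩 v → 𝒩ᴱ (case u v)
𝒩ᴱ-case (acc u) (acc v) = acc λ
  { (ξcasel r) → 𝒩ᴱ-case (u r) (acc v)
  ; (ξcaser r) → 𝒩ᴱ-case (acc u) (v r)
  }

𝒩ᴱ-π₁ : 𝒩ᴱ π₁
𝒩ᴱ-π₁ = acc λ ()

𝒩ᴱ-π₂ : 𝒩ᴱ π₂
𝒩ᴱ-π₂ = acc λ ()

𝒩-app-neutral : ∀ {t e} → Neutral t → 𝒩 t → 𝒩ᴱ e → 𝒩 (app t e)
𝒩-app-neutral n at ae = acc (reduct n at ae)
  where
  reduct : ∀ {t e s} → Neutral t → 𝒩 t → 𝒩ᴱ e → app t e ▷ s → 𝒩 s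
  reduct n (acc t) ae (ξappl r)      = 𝒩-app-neutral (Neutral-▷ n r) (t r) ae
  reduct n at (acc e) (ξappr r)      = 𝒩-app-neutral n at (e r)
  reduct () _ _ β
  reduct () _ _ π₁β
  reduct () _ _ π₂β
  reduct () _ _ ι₁
  reduct () _ _ ι₂
  reduct () _ _ comm
  reduct () _ _ μβ

Neutral⇒𝒩 : ∀ {t} → Neutral t → 𝒩 t
Neutral⇒𝒩 var        = acc λ ()
Neutral⇒𝒩 (app n w)  = 𝒩-app-neutral n (Neutral⇒𝒩 n) (𝒩ᴱ-tm w)
Neutral⇒𝒩 (π₁ n)     = 𝒩-app-neutral n (Neutral⇒𝒩 n) 𝒩ᴱ-π₁
Neutral⇒𝒩 (π₂ n)     = 𝒩-app-neutral n (Neutral⇒𝒩 n) 𝒩ᴱ-π₂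

𝒩-app-head : ∀ {t e} → 𝒩 (app t e) → 𝒩 t
𝒩-app-head (acc s) = acc λ r → 𝒩-app-head (s (ξappl r))

record Saturated (R : Pred Tm 0ℓ) : Set where
  field
    ⊆𝒩      : R ⊆ 𝒩
    neutral : ∀ {t} → Neutral t → t ∈ R

open Saturated

ℛ⇒Saturated : ∀ {R} → ℛ R → Saturated R
ℛ⇒Saturated 𝒩∈ℛ = record { ⊆𝒩 = λ t → t ; neutral = Neutral⇒𝒩 }
ℛ⇒Saturated (⇒∈ℛ hK hL) = record
  { ⊆𝒩     = λ t → 𝒩-app-head (⊆𝒩 L (t (var 0) (neutral K var)))
  ; neutral = λ n u uK → neutral L (app n (⊆𝒩 K uK))
  }
  where K = ℛ⇒Saturated hK; L = ℛ⇒Saturated hL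
ℛ⇒Saturated (∧∈ℛ hK hL) = record
  { ⊆𝒩     = λ (t₁ , _) → 𝒩-app-head (⊆𝒩 K t₁)
  ; neutral = λ n → neutral K (π₁ n) , neutral L (π₂ n)
  }
  where K = ℛ⇒Saturated hK; L = ℛ⇒Saturated hL
ℛ⇒Saturated (∨∈ℛ hK hL) = record
  { ⊆𝒩     = λ t → 𝒩-app-head
      (t (var 0) (var 0) (Neutral⇒𝒩 var) (Neutral⇒𝒩 var) (λ _ → ⊆𝒩 K) (λ _ → ⊆𝒩 L))
  ; neutral = λ n u v u∈𝒩 v∈𝒩 _ _ →
      𝒩-app-neutral n (Neutral⇒𝒩 n) (𝒩ᴱ-case u∈𝒩 v∈𝒩)
  }
  where K = ℛ⇒Saturated hK; L = ℛ⇒Saturated hL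

mainTheorem4 : (R : Pred Tm 0ℓ) → ℛ R →
    (R ⊆ 𝒩) × (∀ (x : ℕ) → var x ∈ R)
mainTheorem4 R h = ⊆𝒩 (ℛ⇒Saturated h) , λ x → neutral (ℛ⇒Saturated h) var
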